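{- Let $k\ge1$ and $p\ge0$, and put $N=A_{k,p}$. Then \[\max_{0\le n<N}\delta_k(n)=M_{k,p}\qquad\text{and}\qquad\min_{0\le n<N}\delta_k(n)=m_{k,p}.\] Consequently $\lim_{p\to\infty}M_{k,p}=\sup_{n\in\mathbb{N}}\delta_k(n)$ and $\lim_{p\to\infty}m_{k,p}=\inf_{n\in\mathbb{N}}\delta_k(n)$.
   Context: For $k\ge1$, $F_k:\mathbb{N}\to\mathbb{N}$ is defined by $F_k(0)=0$ and $F_k(n)=n-F_k^k(n-1)$ for $n\ge1$, where $F_k^k$ is the $k$-fold iterate of $F_k$. $\alpha_k$ is the unique positive real zero of $X^k+X-1$ and $\delta_k(n)=F_k(n)-\alpha_k n$. The sequence $(A_{k,p})_{p\ge0}$ is defined by $A_{k,p}=p+1$ for $0\le p<k$ and $A_{k,p}=A_{k,p-1}+A_{k,p-k}$ for $p\ge k$; $a\ominus b=\max(0,a-b)$. The real sequences $M_{k,p}$, $m_{k,p}$ are defined by $M_{k,0}=m_{k,0}=0$ and, for $p>0$, $M_{k,p}=\max(M_{k,p-1},\,M_{k,p\ominus k}+\delta_k(A_{k,p-1}))$ and $m_{k,p}=\min(m_{k,p-1},\,m_{k,p\ominus k}+\delta_k(A_{k,p-1}))$. -}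

module Defs where

open import Data.Bool using (Bool; true; false; if_then_else_; _∧_; _∨_; T)
open import Data.Nat as ℕ using (ℕ; zero; suc; _∸_; _<ᵇ_)
open import Data.Integer as ℤ using (ℤ; +_; _-_; _*_; _^_; _≤ᵇ_; -_)
open import Data.Product using (_×_; _,_)
open import Function using (_∘_)

-- Course-of-values recursion.
-- 'tab step n' is a table valid on arguments m < n; 'cov step n' is the
-- value at n, where 'step n prev' may only consult 'prev m' for m < n.

tab : {A : Set} → A → ((n : ℕ) → (ℕ → A) → A) → ℕ → ℕ → A
tab d step zero    m = d
tab d step (suc n) m = if m <ᵇ n then tab d step n m else step n (tab d step n)

cov : {A : Set} → A → ((n : ℕ) → (ℕ → A) → A) → ℕ → A
cov d step n = tab d step (suc n) n

iter : {A : Set} → ℕ → (A → A) → A → A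
iter zero    f x = x
iter (suc k) f x = f (iter k f x)

-- F_k(0) = 0, F_k(n) = n - F_k^k(n-1).  (Since F_k(m) ≤ m, the inner
-- iterate only consults values at arguments < n, and the truncated
-- subtraction is the ordinary one.)

F : ℕ → ℕ → ℕ
F k = cov 0 step
  where
  step : ℕ → (ℕ → ℕ) → ℕ
  step zero    prev = 0
  step (suc n) prev = suc n ∸ iter k prev n

A : ℕ → ℕ → ℕ
A k = cov 0 step
  where
  step : ℕ → (ℕ → ℕ) → ℕ
  step p prev = if p <ᵇ k then suc p else prev (p ∸ 1) ℕ.+ prev (p ∸ k)

-- Exact arithmetic in ℤ[α_k], α_k the unique positive root of X^k+X-1.
-- A value (a , b) : Val denotes the real number  a - b·α_k.
-- All quantities of the statement (δ_k(n), M_{k,p}, m_{k,p}) are of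
-- this form.

Val : Set
Val = ℤ × ℤ

denZero : Val
denZero = (+ 0 , + 0)

_⊕_ : Val → Val → Val
(a , b) ⊕ (c , d) = (a ℤ.+ c , b ℤ.+ d)

δ : ℕ → ℕ → Val
δ k n = (+ F k n , + n)

-- leqα k u v  decides  u ≤ v·α_k  (u v : ℤ), using that α_k ∈ (0,1) is
-- the unique positive root of f(X) = X^k + X - 1, f increasing on [0,∞):
--   v = 0 :  u ≤ 0
--   v > 0 :  u ≤ 0, or  u/v ≤ α  i.e.  f(u/v) ≤ 0  i.e.  u^k + u v^(k-1) ≤ v^k
--   v < 0 :  (w = -v, u' = -u)  α ≤ u'/w  i.e.  u' ≥ 0 and u'^k + u' w^(k-1) ≥ w^k
leqα : ℕ → ℤ → ℤ → Bool
leqα k u (+ zero)    = u ≤ᵇ + 0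
leqα k u (+ (suc n)) = (u ≤ᵇ + 0) ∨ ((u ^ k) ℤ.+ u * (v ^ (k ∸ 1)) ≤ᵇ v ^ k)
  where v = + suc n
leqα k u ℤ.-[1+ n ]  = (+ 0 ≤ᵇ u') ∧ (w ^ k ≤ᵇ (u' ^ k) ℤ.+ u' * (w ^ (k ∸ 1)))
  where
  w  = + suc n
  u' = - u

-- (a - bα) ≤ (c - dα)  iff  a - c ≤ (b - d)α
leqV : ℕ → Val → Val → Bool
leqV k (a , b) (c , d) = leqα k (a - c) (b - d)

_≤[_]_ : Val → ℕ → Val → Set
x ≤[ k ] y = T (leqV k x y)

_≈[_]_ : Val → ℕ → Val → Set
x ≈[ k ] y = x ≤[ k ] y × y ≤[ k ] x

maxV minV : ℕ → Val → Val → Val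
maxV k x y = if leqV k x y then y else x
minV k x y = if leqV k x y then x else y

-- M_{k,0} = m_{k,0} = 0,
-- M_{k,p} = max(M_{k,p-1}, M_{k,p⊖k} + δ_k(A_{k,p-1}))  (p > 0),
-- m_{k,p} = min(m_{k,p-1}, m_{k,p⊖k} + δ_k(A_{k,p-1}))  (p > 0).
-- (p ⊖ k = p ∸ k on ℕ; for k ≥ 1 and p > 0 we have p ∸ k < p.)

M : ℕ → ℕ → Val
M k = cov denZero step
  where
  step : ℕ → (ℕ → Val) → Val
  step zero    prev = denZero
  step (suc p) prev = maxV k (prev p) (prev (suc p ∸ k) ⊕ δ k (A k p))

m : ℕ → ℕ → Val
m k = cov denZero step
  where
  step : ℕ → (ℕ → Val) → Val
  step zero    prev = denZero
  step (suc p) prev = minV k (prev p) (prev (suc p ∸ k) ⊕ δ k (A k p))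

{-# OPTIONS --safe #-}
module Submission where

-- [0, A_{k,p+1}) is [0, A_{k,p}) followed by A_{k,p} + [0, A_{k,p+1-k}), and on the second block
-- F_k is additive: F_k(A_{k,p} + r) = F_k(A_{k,p}) + F_k(r), so δ_k(A_{k,p} + r) = δ_k(r) + δ_k(A_{k,p}).
-- Hence the maximum and minimum of δ_k below A_{k,p+1} satisfy the very recursions defining
-- M_{k,p+1} and m_{k,p+1}. As p < A_{k,p}, every δ_k(n) lies between m_{k,n} and M_{k,n}, and these
-- monotone sequences consist of values of δ_k, which gives the limit statements.
--
-- Additivity follows from F_k(A_{k,i} + s) = A_{k,i-1} + F_k(s) for i ≥ 1 and s ≤ A_{k,i+1-k}, proved
-- by strong induction on A_{k,i} + s: the iterate F_k^k sends A_{k,i} + t to A_{k,i-k} + F_k^k(t),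
-- and A_{k,i} - A_{k,i-k} = A_{k,i-1}.
--
-- The reals a - bα_k are compared exactly: u ≤ vα_k says that (u , v) lies in a half-plane through
-- the origin, and closure of that half-plane under addition makes the comparison a total preorder
-- compatible with addition.

open import Defs
open import Data.Bool using (true; false; T; if_then_else_)
open import Data.Bool.Properties using (T-≡; T-∨; T-∧)
open import Data.Nat
  using ( ℕ; zero; suc; pred; _+_; _∸_; _*_; _^_; _≤_; _<_; _<ᵇ_; z≤n; s≤s; _<?_
        ; NonZero; >-nonZero )
open import Data.Nat.Properties
open import Data.Nat.Induction using (<-rec)
open import Data.Nat.Solver renaming (module +-*-Solver to NatSolver)
open import Data.Integer as ℤ using (ℤ; -[1+_]; +[1+_]; +≤+; -≤+; -≤-)
open import Data.Integer.Solver renaming (module +-*-Solver to IntSolver)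
import Data.Integer.Properties as ℤ
open import Data.Product using (_×_; _,_; proj₁; proj₂; ∃-syntax; map₂; swap)
open import Data.Sum using (_⊎_; inj₁; inj₂)
open import Function using (_∘_)
open import Function.Bundles using (Equivalence)
open import Relation.Nullary using (yes; no; contradiction)
open import Relation.Binary.PropositionalEquality

<ᵇ≡true : ∀ {m n} → m < n → (m <ᵇ n) ≡ true
<ᵇ≡true = Equivalence.to T-≡ ∘ <⇒<ᵇ

<ᵇ≡false : ∀ {m n} → n ≤ m → (m <ᵇ n) ≡ false
<ᵇ≡false {m} {n} n≤m with m <ᵇ n in eq
... | false = refl
... | true  = contradiction (<ᵇ⇒< m n (subst T (sym eq) _)) (≤⇒≯ n≤m)

module _ {X : Set} (d : X) (step : ℕ → (ℕ → X) → X) where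

  tab≡cov : ∀ {n j} → j < n → tab d step n j ≡ cov d step j
  tab≡cov {suc n} {j} j<1+n with m<1+n⇒m<n∨m≡n j<1+n
  ... | inj₁ j<n rewrite <ᵇ≡true j<n = tab≡cov j<n
  ... | inj₂ refl rewrite <ᵇ≡false (≤-refl {j}) = refl

  cov-step : ∀ n → ∃[ t ] (cov d step n ≡ step n t × (∀ {j} → j < n → t j ≡ cov d step j))
  cov-step n rewrite <ᵇ≡false (≤-refl {n}) = tab d step n , refl , tab≡cov

[m+n+o]∸[n+p]≡m+[o∸p] : ∀ m n o p → p ≤ o → m + n + o ∸ (n + p) ≡ m + (o ∸ p)
[m+n+o]∸[n+p]≡m+[o∸p] m n o p p≤o = begin
  m + n + o ∸ (n + p)   ≡⟨ cong (_∸ (n + p)) (trans (cong (_+ o) (+-comm m n)) (+-assoc n m o)) ⟩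
  n + (m + o) ∸ (n + p) ≡⟨ [m+n]∸[m+o]≡n∸o n (m + o) p ⟩
  m + o ∸ p             ≡⟨ +-∸-assoc m p≤o ⟩
  m + (o ∸ p)           ∎
  where open ≡-Reasoning

^-distribʳ-* : ∀ m n o → (m * n) ^ o ≡ m ^ o * n ^ o
^-distribʳ-* m n zero    = refl
^-distribʳ-* m n (suc o) =
  trans (cong (m * n *_) (^-distribʳ-* m n o)) ([m*n]*[o*p]≡[m*o]*[n*p] m n (m ^ o) (n ^ o))

pos-^ : ∀ a n → (ℤ.+ a) ℤ.^ n ≡ ℤ.+ (a ^ n)
pos-^ a zero    = refl
pos-^ a (suc n) = trans (cong (ℤ.+ a ℤ.*_) (pos-^ a n)) (sym (ℤ.pos-* a (a ^ n)))

UnitStep : (ℕ → ℕ) → ℕ → Set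
UnitStep f n = f n ≤ f (suc n) × f (suc n) ≤ suc (f n)

mono-≤-from-steps : ∀ {f : ℕ → ℕ} → (∀ n → f n ≤ f (suc n)) → ∀ {x y} → x ≤ y → f x ≤ f y
mono-≤-from-steps {f} up {x} {zero}  z≤n = ≤-refl
mono-≤-from-steps {f} up {x} {suc y} x≤1+y with m≤n⇒m<n∨m≡n x≤1+y
... | inj₁ x<1+y = ≤-trans (mono-≤-from-steps up (≤-pred x<1+y)) (up y)
... | inj₂ refl  = ≤-refl

module _ {g : ℕ → ℕ} (g≤id : ∀ x → g x ≤ x) where

  iter-≤ : ∀ i x → iter i g x ≤ x
  iter-≤ zero    x = ≤-refl
  iter-≤ (suc i) x = ≤-trans (g≤id _) (iter-≤ i x)

  iter-cong-≤ : ∀ {h n} → (∀ {j} → j ≤ n → h j ≡ g j) →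
                ∀ i {x} → x ≤ n → iter i h x ≡ iter i g x
  iter-cong-≤ h≗g zero    x≤n = refl
  iter-cong-≤ h≗g (suc i) x≤n rewrite iter-cong-≤ h≗g i x≤n =
    h≗g (≤-trans (iter-≤ i _) x≤n)

  iter-unitStep : ∀ {n} → (∀ {j} → j ≤ n → UnitStep g j) → ∀ i → UnitStep (iter i g) n
  iter-unitStep {n} steps zero = n≤1+n n , ≤-refl
  iter-unitStep {n} steps (suc i) with iter-unitStep steps i
  ... | lo , hi with m≤n⇒m<n∨m≡n lo
  ... | inj₂ same rewrite same = ≤-refl , n≤1+n _
  ... | inj₁ up rewrite ≤-antisym hi up = steps (iter-≤ i n)

module Hofstadter (k′ : ℕ) where
  private
    k : ℕ
    k = suc k′

    F-unfold : ∀ n → ∃[ t ] (F k (suc n) ≡ suc n ∸ iter k t n × (∀ {j} → j < suc n → t j ≡ F k j))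
    F-unfold n = cov-step 0 _ (suc n)

  F-≤ : ∀ n → F k n ≤ n
  F-≤ zero    = z≤n
  F-≤ (suc n) with F-unfold n
  ... | t , eq , _ = ≤-trans (≤-reflexive eq) (m∸n≤m (suc n) (iter k t n))

  F-suc : ∀ n → F k (suc n) ≡ suc n ∸ iter k (F k) n
  F-suc n with F-unfold n
  ... | t , eq , t≗F = trans eq (cong (suc n ∸_) (iter-cong-≤ F-≤ (λ j≤n → t≗F (s≤s j≤n)) k ≤-refl))

  F-unitStep : ∀ n → UnitStep (F k) n
  F-unitStep = <-rec (UnitStep (F k)) step
    where
    step : ∀ n → (∀ {j} → j < n → UnitStep (F k) j) → UnitStep (F k) n
    step zero    _   = z≤n , F-≤ 1
    step (suc n) rec rewrite F-suc n | F-suc (suc n)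
      with iter-unitStep F-≤ (λ j≤n → rec (s≤s j≤n)) k
    ... | lo , hi = ∸-monoʳ-≤ (suc (suc n)) hi ,
                    ≤-trans (∸-monoʳ-≤ (suc (suc n)) lo)
                            (≤-reflexive (+-∸-assoc 1 (≤-trans (iter-≤ F-≤ k n) (n≤1+n n))))

  F-mono : ∀ {x y} → x ≤ y → F k x ≤ F k y
  F-mono = mono-≤-from-steps (λ n → proj₁ (F-unitStep n))

  F-one : F k 1 ≡ 1
  F-one = trans (F-suc 0) (cong (1 ∸_) (n≤0⇒n≡0 (iter-≤ F-≤ k 0)))

  F-small : ∀ y → y < k → F k (suc (suc y)) ≡ suc y
  F-small = <-rec (λ y → y < k → F k (suc (suc y)) ≡ suc y) small
    where
    small : ∀ y → (∀ {w} → w < y → w < k → F k (suc (suc w)) ≡ suc w) →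
            y < k → F k (suc (suc y)) ≡ suc y
    small y rec y<k = begin
      F k (suc (suc y))                  ≡⟨ F-suc (suc y) ⟩
      suc (suc y) ∸ iter k (F k) (suc y) ≡⟨ cong (suc (suc y) ∸_) (descend k) ⟩
      suc (suc y) ∸ suc (y ∸ k)          ≡⟨ cong (λ z → suc y ∸ z) (m≤n⇒m∸n≡0 (<⇒≤ y<k)) ⟩
      suc y                              ∎
      where
      open ≡-Reasoning
      F-below : ∀ z → z ≤ y → F k (suc z) ≡ suc (pred z)
      F-below zero    _   = F-one
      F-below (suc w) w<y = rec w<y (<-trans w<y y<k)
      descend : ∀ j → iter j (F k) (suc y) ≡ suc (y ∸ j)
      descend zero    = refl
      descend (suc j) = begin
        F k (iter j (F k) (suc y)) ≡⟨ cong (F k) (descend j) ⟩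
        F k (suc (y ∸ j))          ≡⟨ F-below (y ∸ j) (m∸n≤m y j) ⟩
        suc (pred (y ∸ j))         ≡⟨ cong suc (pred[m∸n]≡m∸[1+n] y j) ⟩
        suc (y ∸ suc j)            ∎

  private
    A-unfold : ∀ p → ∃[ t ] (A k p ≡ (if p <ᵇ k then suc p else t (p ∸ 1) + t (p ∸ k))
                             × (∀ {j} → j < p → t j ≡ A k j))
    A-unfold p = cov-step 0 _ p

  A-small : ∀ {p} → p < k → A k p ≡ suc p
  A-small {p} p<k with A-unfold p
  ... | t , eq , _ rewrite <ᵇ≡true p<k = eq

  A-rec : ∀ p → A k (suc p) ≡ A k p + A k (suc p ∸ k)
  A-rec p with suc p <? k | A-unfold (suc p)
  ... | yes 1+p<k | _ rewrite A-small 1+p<k | A-small (<-trans (n<1+n p) 1+p<k)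
                             | m≤n⇒m∸n≡0 (<⇒≤ 1+p<k) = cong suc (+-comm 1 p)
  ... | no 1+p≮k | t , eq , t≗A rewrite <ᵇ≡false (≮⇒≥ 1+p≮k) =
    trans eq (cong₂ _+_ (t≗A ≤-refl) (t≗A (s≤s (m∸n≤m p k′))))

  A-pos : ∀ p → 1 ≤ A k p
  A-pos zero    = ≤-refl
  A-pos (suc p) rewrite A-rec p = ≤-trans (A-pos p) (m≤m+n _ _)

  A-mono : ∀ {p q} → p ≤ q → A k p ≤ A k q
  A-mono = mono-≤-from-steps (λ p → subst (A k p ≤_) (sym (A-rec p)) (m≤m+n _ _))

  p<A[p] : ∀ p → p < A k p
  p<A[p] zero    = A-pos 0
  p<A[p] (suc p) rewrite A-rec p =
    ≤-trans (≤-reflexive (cong suc (+-comm 1 p))) (+-mono-≤ (p<A[p] p) (A-pos (suc p ∸ k)))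

  A-≤k : ∀ {i} → i ≤ k → A k i ≡ suc i
  A-≤k {i} i≤k with m≤n⇒m<n∨m≡n i≤k
  ... | inj₁ i<k  = A-small i<k
  ... | inj₂ refl rewrite A-rec k′ | A-small (n<1+n k′) | n∸n≡0 k′ = cong suc (+-comm k′ 1)

  Shift : ℕ → ℕ → Set
  Shift i s = F k (A k i + s) ≡ A k (pred i) + F k s

  ShiftBelow : ℕ → Set
  ShiftBelow N = ∀ {i s} → 1 ≤ i → s ≤ A k (suc i ∸ k) → A k i + s < N → Shift i s

  shift-small-zero : ∀ {i} → i < k → Shift (suc i) 0
  shift-small-zero {i} i<k = begin
    F k (A k (suc i) + 0) ≡⟨ cong (λ a → F k (a + 0)) (A-≤k i<k) ⟩
    F k (suc (suc i) + 0) ≡⟨ cong (F k) (+-identityʳ (suc (suc i))) ⟩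
    F k (suc (suc i))     ≡⟨ F-small i i<k ⟩
    suc i                 ≡⟨ sym (+-identityʳ (suc i)) ⟩
    suc i + 0             ≡⟨ cong (_+ 0) (sym (A-small i<k)) ⟩
    A k i + F k 0         ∎
    where open ≡-Reasoning

  shift-small-one : ∀ {i} → suc i < k → Shift (suc i) 1
  shift-small-one {i} 1+i<k = begin
    F k (A k (suc i) + 1) ≡⟨ cong (λ a → F k (a + 1)) (A-small 1+i<k) ⟩
    F k (suc (suc i) + 1) ≡⟨ cong (F k) (+-comm (suc (suc i)) 1) ⟩
    F k (suc (suc (suc i))) ≡⟨ F-small (suc i) 1+i<k ⟩
    suc (suc i)           ≡⟨ +-comm 1 (suc i) ⟩
    suc i + 1             ≡⟨ cong₂ _+_ (sym (A-small (<-trans (n<1+n i) 1+i<k))) (sym F-one) ⟩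
    A k i + F k 1         ∎
    where open ≡-Reasoning

  module ShiftStep {N : ℕ} (shift-below : ShiftBelow N) where

    F-A-below : ∀ {m} → A k (suc m) < N → F k (A k (suc m)) ≡ A k m
    F-A-below {m} A<N = begin
      F k (A k (suc m))     ≡⟨ cong (F k) (sym (+-identityʳ (A k (suc m)))) ⟩
      F k (A k (suc m) + 0) ≡⟨ shift-below {suc m} {0} (s≤s z≤n) z≤n
                                 (subst (_< N) (sym (+-identityʳ (A k (suc m)))) A<N) ⟩
      A k m + 0             ≡⟨ +-identityʳ (A k m) ⟩
      A k m                 ∎
      where open ≡-Reasoning

    F-bound : ∀ {i x} → A k (suc i) < N → x ≤ A k (suc (suc i) ∸ k) → F k x ≤ A k (suc i ∸ k)
    F-bound {i} {x} A<N x≤b with k ≤? suc i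
    ... | yes k≤1+i rewrite +-∸-assoc 1 k≤1+i =
      ≤-trans (F-mono x≤b)
              (≤-reflexive (F-A-below {suc i ∸ k} (≤-<-trans (A-mono (s≤s (m∸n≤m i k′))) A<N)))
    ... | no  k≰1+i rewrite m≤n⇒m∸n≡0 (≰⇒> k≰1+i) | m≤n⇒m∸n≡0 (<⇒≤ (≰⇒> k≰1+i)) =
      ≤-trans (F-mono x≤b) (≤-reflexive F-one)

    iter-bound : ∀ {i t} → A k i < N → t ≤ A k (suc i ∸ k) →
                 ∀ j → j ≤ i → iter j (F k) t ≤ A k (suc (i ∸ j) ∸ k)
    iter-bound {i} {t} A<N t≤b zero    _   = t≤b
    iter-bound {i} {t} A<N t≤b (suc j) j<i =
      F-bound (subst (λ m → A k m < N) i∸j≡1+i∸[1+j] (≤-<-trans (A-mono (m∸n≤m i j)) A<N))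
              (subst (λ m → iter j (F k) t ≤ A k (suc m ∸ k)) i∸j≡1+i∸[1+j]
                     (iter-bound A<N t≤b j (<⇒≤ j<i)))
      where
      i∸j≡1+i∸[1+j] : i ∸ j ≡ suc (i ∸ suc j)
      i∸j≡1+i∸[1+j] = +-∸-assoc 1 j<i

    iter-shift : ∀ {i t} → t ≤ A k (suc i ∸ k) → A k i + t < N →
                 ∀ j → j ≤ i → iter j (F k) (A k i + t) ≡ A k (i ∸ j) + iter j (F k) t
    iter-shift         t≤b A+t<N zero    _   = refl
    iter-shift {i} {t} t≤b A+t<N (suc j) j<i = begin
      F k (iter j (F k) (A k i + t))            ≡⟨ cong (F k) shifted ⟩
      F k (A k (i ∸ j) + iter j (F k) t)        ≡⟨ shift-below (m<n⇒0<n∸m j<i) bound below ⟩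
      A k (pred (i ∸ j)) + iter (suc j) (F k) t ≡⟨ cong (λ m → A k m + iter (suc j) (F k) t)
                                                         (pred[m∸n]≡m∸[1+n] i j) ⟩
      A k (i ∸ suc j) + iter (suc j) (F k) t    ∎
      where
      open ≡-Reasoning
      shifted = iter-shift t≤b A+t<N j (<⇒≤ j<i)
      bound = iter-bound (≤-<-trans (m≤m+n (A k i) t) A+t<N) t≤b j (<⇒≤ j<i)
      below = ≤-<-trans (subst (_≤ A k i + t) shifted (iter-≤ F-≤ j (A k i + t))) A+t<N

    shift-suc : ∀ {i s} → k ≤ suc i → s ≤ A k (suc (suc i) ∸ k) → A k (suc i) + s < N →
                Shift (suc i) (suc s)
    shift-suc {i} {s} k≤1+i s≤b A+s<N = begin
      F k (A k (suc i) + suc s)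
        ≡⟨ cong (F k) (+-suc (A k (suc i)) s) ⟩
      F k (suc (A k (suc i) + s))
        ≡⟨ F-suc (A k (suc i) + s) ⟩
      suc (A k (suc i) + s) ∸ iter k (F k) (A k (suc i) + s)
        ≡⟨ cong₂ _∸_ (sym (+-suc (A k (suc i)) s)) (iter-shift s≤b A+s<N k k≤1+i) ⟩
      A k (suc i) + suc s ∸ (A k (suc i ∸ k) + Z)
        ≡⟨ cong (λ a → a + suc s ∸ (A k (suc i ∸ k) + Z)) (A-rec i) ⟩
      A k i + A k (suc i ∸ k) + suc s ∸ (A k (suc i ∸ k) + Z)
        ≡⟨ [m+n+o]∸[n+p]≡m+[o∸p] (A k i) (A k (suc i ∸ k)) (suc s) Z
             (≤-trans (iter-≤ F-≤ k s) (n≤1+n s)) ⟩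
      A k i + (suc s ∸ Z)
        ≡⟨ cong (A k i +_) (sym (F-suc s)) ⟩
      A k i + F k (suc s) ∎
      where
      open ≡-Reasoning
      Z = iter k (F k) s

    -- A k (i + 2) = A k (i + 1) + c, so this is shift-suc at i + 1 with s = c - 1.
    shift-zero : ∀ {i} → k ≤ suc i → A k (suc (suc i)) ≤ N → Shift (suc (suc i)) 0
    shift-zero {i} k≤1+i A≤N = begin
      F k (A k (suc (suc i)) + 0)         ≡⟨ cong (F k) (+-identityʳ (A k (suc (suc i)))) ⟩
      F k (A k (suc (suc i)))             ≡⟨ cong (F k) A[2+i]≡A[1+i]+[1+t] ⟩
      F k (A k (suc i) + suc t)           ≡⟨ shift-suc k≤1+i pred[n]≤n A+t<N ⟩
      A k i + F k (suc t)                 ≡⟨ cong (λ x → A k i + F k x) 1+t≡c ⟩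
      A k i + F k c                       ≡⟨ cong (λ m → A k i + F k (A k m)) 2+i∸k≡1+[1+i∸k] ⟩
      A k i + F k (A k (suc (suc i ∸ k))) ≡⟨ cong (A k i +_) (F-A-below {suc i ∸ k} c<N) ⟩
      A k i + A k (suc i ∸ k)             ≡⟨ sym (A-rec i) ⟩
      A k (suc i)                         ≡⟨ sym (+-identityʳ (A k (suc i))) ⟩
      A k (suc i) + F k 0                 ∎
      where
      open ≡-Reasoning
      c = A k (suc (suc i) ∸ k)
      t = pred c
      1+t≡c : suc t ≡ c
      1+t≡c = suc-pred c {{>-nonZero (A-pos (suc (suc i) ∸ k))}}
      A[2+i]≡A[1+i]+[1+t] : A k (suc (suc i)) ≡ A k (suc i) + suc t
      A[2+i]≡A[1+i]+[1+t] = trans (A-rec (suc i)) (cong (A k (suc i) +_) (sym 1+t≡c))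
      A+c≤N : A k (suc i) + c ≤ N
      A+c≤N = subst (_≤ N) (A-rec (suc i)) A≤N
      2+i∸k≡1+[1+i∸k] : suc (suc i) ∸ k ≡ suc (suc i ∸ k)
      2+i∸k≡1+[1+i∸k] = +-∸-assoc 1 k≤1+i
      c<N : A k (suc (suc i ∸ k)) < N
      c<N = subst (λ m → A k m < N) 2+i∸k≡1+[1+i∸k]
                  (<-≤-trans (m<n+m c (A-pos (suc i))) A+c≤N)
      A+t<N : A k (suc i) + t < N
      A+t<N = subst (_≤ N) (trans (cong (A k (suc i) +_) (sym 1+t≡c)) (+-suc (A k (suc i)) t))
                    A+c≤N

    shift : ∀ {i s} → 1 ≤ i → s ≤ A k (suc i ∸ k) → A k i + s ≤ N → Shift i s
    shift {suc zero} {zero} _ _ _ = shift-small-zero (s≤s z≤n)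
    shift {suc (suc i)} {zero} _ _ A+0≤N with suc i <? k
    ... | yes 1+i<k = shift-small-zero 1+i<k
    ... | no  1+i≮k =
      shift-zero (≮⇒≥ 1+i≮k) (subst (_≤ N) (+-identityʳ (A k (suc (suc i)))) A+0≤N)
    shift {suc i} {suc s} _ 1+s≤b A+1+s≤N with k ≤? suc i
    ... | yes k≤1+i = shift-suc k≤1+i (≤-trans (n≤1+n s) 1+s≤b)
                        (subst (_≤ N) (+-suc (A k (suc i)) s) A+1+s≤N)
    ... | no  k≰1+i
      rewrite n≤0⇒n≡0 (≤-pred (subst (λ m → suc s ≤ A k m) (m≤n⇒m∸n≡0 (≰⇒> k≰1+i)) 1+s≤b)) =
      shift-small-one (≰⇒> k≰1+i)

  shift-below : ∀ N → ShiftBelow N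
  shift-below (suc N) 1≤i s≤b A+s<1+N = ShiftStep.shift (shift-below N) 1≤i s≤b (≤-pred A+s<1+N)

  F-shift : ∀ {i s} → 1 ≤ i → s ≤ A k (suc i ∸ k) → F k (A k i + s) ≡ A k (pred i) + F k s
  F-shift {i} {s} 1≤i s≤b = shift-below (suc (A k i + s)) 1≤i s≤b ≤-refl

  F-A : ∀ p → F k (A k (suc p)) ≡ A k p
  F-A p = begin
    F k (A k (suc p))     ≡⟨ cong (F k) (sym (+-identityʳ (A k (suc p)))) ⟩
    F k (A k (suc p) + 0) ≡⟨ F-shift {suc p} {0} (s≤s z≤n) z≤n ⟩
    A k p + 0             ≡⟨ +-identityʳ (A k p) ⟩
    A k p                 ∎
    where open ≡-Reasoning

  F[A+r]≡F[A]+F[r] : ∀ p {r} → r < A k (suc p ∸ k) → F k (A k p + r) ≡ F k (A k p) + F k r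
  F[A+r]≡F[A]+F[r] zero {r} r<b with n<1⇒n≡0 (subst (λ m → r < A k m) (0∸n≡0 k′) r<b)
  ... | refl = sym (+-identityʳ (F k 1))
  F[A+r]≡F[A]+F[r] (suc p) {r} r<b =
    trans (F-shift (s≤s z≤n) (<⇒≤ r<b)) (cong (_+ F k r) (sym (F-A p)))

  A-split : ∀ p {n} → n < A k (suc p) → n < A k p ⊎ ∃[ r ] (r < A k (suc p ∸ k) × n ≡ A k p + r)
  A-split p {n} n<A with n <? A k p
  ... | yes n<Ap = inj₁ n<Ap
  ... | no  n≮Ap = inj₂ (n ∸ A k p , r<b , sym (m+[n∸m]≡n (≮⇒≥ n≮Ap)))
    where
    r<b : n ∸ A k p < A k (suc p ∸ k)
    r<b = subst (n ∸ A k p <_) (m+n∸m≡n (A k p) (A k (suc p ∸ k)))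
                (∸-monoˡ-< (subst (n <_) (A-rec p) n<A) (≮⇒≥ n≮Ap))

  δ[A+r]≡δ[r]⊕δ[A] : ∀ p {r} → r < A k (suc p ∸ k) → δ k (A k p + r) ≡ δ k r ⊕ δ k (A k p)
  δ[A+r]≡δ[r]⊕δ[A] p {r} r<b = cong₂ (λ f n → (ℤ.+ f , ℤ.+ n))
    (trans (F[A+r]≡F[A]+F[r] p r<b) (+-comm (F k (A k p)) (F k r))) (+-comm (A k p) r)

module RootOrder (k′ : ℕ) where
  open import Data.Integer using (+_)

  private
    k : ℕ
    k = suc k′

  -- Φ a b = b ^ k · g (a / b) for g(x) = x ^ k + x, which is increasing on [0, ∞) with g α = 1;
  -- hence a ≤ α b iff Φ a b ≤ b ^ k, for all a b : ℕ.
  Φ : ℕ → ℕ → ℕ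
  Φ a b = a ^ k + a * b ^ k′

  infix 4 _≤α·_ _≥α·_

  _≤α·_ : ℕ → ℕ → Set
  a ≤α· b = Φ a b ≤ b ^ k

  _≥α·_ : ℕ → ℕ → Set
  a ≥α· b = b ^ k ≤ Φ a b

  Φ-homogeneous : ∀ a b d → Φ a b * d ^ k ≡ Φ (a * d) (b * d)
  Φ-homogeneous a b d rewrite ^-distribʳ-* a d k′ | ^-distribʳ-* b d k′ =
    solve 5 (λ a d A B D → (a :* A :+ a :* B) :* (d :* D)
                         := (a :* d) :* (A :* D) :+ (a :* d) :* (B :* D))
            refl a d (a ^ k′) (b ^ k′) (d ^ k′)
    where open NatSolver

  Φ-monoˡ-≤ : ∀ {a a′} b → a ≤ a′ → Φ a b ≤ Φ a′ b
  Φ-monoˡ-≤ b a≤a′ = +-mono-≤ (^-monoˡ-≤ k a≤a′) (*-monoˡ-≤ (b ^ k′) a≤a′)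

  Φ-monoˡ-< : ∀ {a a′} b → a < a′ → Φ a b < Φ a′ b
  Φ-monoˡ-< b a<a′ = +-mono-<-≤ (^-monoˡ-< k a<a′) (*-monoˡ-≤ (b ^ k′) (<⇒≤ a<a′))

  -- In the next two lemmas the cross-multiplied hypothesis says a / b ≤ a′ / b′.
  ≤α·-anti : ∀ {a b a′ b′} .{{_ : NonZero b′}} → a * b′ ≤ a′ * b → a′ ≤α· b′ → a ≤α· b
  ≤α·-anti {a} {b} {a′} {b′} ab′≤a′b a′≤αb′ =
    *-cancelʳ-≤ (Φ a b) (b ^ k) (b′ ^ k) {{m^n≢0 b′ k}} (begin
    Φ a b * b′ ^ k         ≡⟨ Φ-homogeneous a b b′ ⟩
    Φ (a * b′) (b * b′)    ≤⟨ Φ-monoˡ-≤ (b * b′) ab′≤a′b ⟩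
    Φ (a′ * b) (b * b′)    ≡⟨ cong (Φ (a′ * b)) (*-comm b b′) ⟩
    Φ (a′ * b) (b′ * b)    ≡⟨ Φ-homogeneous a′ b′ b ⟨
    Φ a′ b′ * b ^ k        ≤⟨ *-monoˡ-≤ (b ^ k) a′≤αb′ ⟩
    b′ ^ k * b ^ k         ≡⟨ *-comm (b′ ^ k) (b ^ k) ⟩
    b ^ k * b′ ^ k         ∎)
    where open ≤-Reasoning

  ≥α·-mono : ∀ {a b a′ b′} .{{_ : NonZero b′}} → a′ * b ≤ a * b′ → a′ ≥α· b′ → a ≥α· b
  ≥α·-mono {a} {b} {a′} {b′} a′b≤ab′ a′≥αb′ =
    *-cancelʳ-≤ (b ^ k) (Φ a b) (b′ ^ k) {{m^n≢0 b′ k}} (begin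
    b ^ k * b′ ^ k         ≡⟨ *-comm (b ^ k) (b′ ^ k) ⟩
    b′ ^ k * b ^ k         ≤⟨ *-monoˡ-≤ (b ^ k) a′≥αb′ ⟩
    Φ a′ b′ * b ^ k        ≡⟨ Φ-homogeneous a′ b′ b ⟩
    Φ (a′ * b) (b′ * b)    ≡⟨ cong (Φ (a′ * b)) (*-comm b′ b) ⟩
    Φ (a′ * b) (b * b′)    ≤⟨ Φ-monoˡ-≤ (b * b′) a′b≤ab′ ⟩
    Φ (a * b′) (b * b′)    ≡⟨ Φ-homogeneous a b b′ ⟨
    Φ a b * b′ ^ k         ∎)
    where open ≤-Reasoning

  ≤α·-≥α·-cross : ∀ {a b c d} → a ≤α· b → c ≥α· d → a * d ≤ c * b
  ≤α·-≥α·-cross {a} {b} {c} {d} a≤αb c≥αd with a * d ≤? c * b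
  ... | yes ad≤cb = ad≤cb
  ... | no  ad≰cb = contradiction (begin-strict
    Φ c d * b ^ k          ≡⟨ Φ-homogeneous c d b ⟩
    Φ (c * b) (d * b)      <⟨ Φ-monoˡ-< (d * b) (≰⇒> ad≰cb) ⟩
    Φ (a * d) (d * b)      ≡⟨ cong (Φ (a * d)) (*-comm d b) ⟩
    Φ (a * d) (b * d)      ≡⟨ Φ-homogeneous a b d ⟨
    Φ a b * d ^ k          ≤⟨ *-monoˡ-≤ (d ^ k) a≤αb ⟩
    b ^ k * d ^ k          ≡⟨ *-comm (b ^ k) (d ^ k) ⟩
    d ^ k * b ^ k          ≤⟨ *-monoˡ-≤ (b ^ k) c≥αd ⟩
    Φ c d * b ^ k          ∎) (<-irrefl refl)
    where open ≤-Reasoning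

  ≤α·-mediant : ∀ {a b a′ b′} .{{_ : NonZero b}} .{{_ : NonZero b′}} →
                a ≤α· b → a′ ≤α· b′ → a + a′ ≤α· b + b′
  ≤α·-mediant {a} {b} {a′} {b′} a≤αb a′≤αb′ with ≤-total (a * b′) (a′ * b)
  ... | inj₁ ab′≤a′b = ≤α·-anti {a + a′} {b + b′} {a′} {b′} (begin
    (a + a′) * b′          ≡⟨ *-distribʳ-+ b′ a a′ ⟩
    a * b′ + a′ * b′       ≤⟨ +-monoˡ-≤ (a′ * b′) ab′≤a′b ⟩
    a′ * b + a′ * b′       ≡⟨ *-distribˡ-+ a′ b b′ ⟨
    a′ * (b + b′)          ∎) a′≤αb′
    where open ≤-Reasoning
  ... | inj₂ a′b≤ab′ = ≤α·-anti {a + a′} {b + b′} {a} {b} (begin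
    (a + a′) * b           ≡⟨ *-distribʳ-+ b a a′ ⟩
    a * b + a′ * b         ≤⟨ +-monoʳ-≤ (a * b) a′b≤ab′ ⟩
    a * b + a * b′         ≡⟨ *-distribˡ-+ a b b′ ⟨
    a * (b + b′)           ∎) a≤αb
    where open ≤-Reasoning

  ≥α·-mediant : ∀ {a b a′ b′} .{{_ : NonZero b}} .{{_ : NonZero b′}} →
                a ≥α· b → a′ ≥α· b′ → a + a′ ≥α· b + b′
  ≥α·-mediant {a} {b} {a′} {b′} a≥αb a′≥αb′ with ≤-total (a * b′) (a′ * b)
  ... | inj₁ ab′≤a′b = ≥α·-mono {a + a′} {b + b′} {a} {b} (begin
    a * (b + b′)           ≡⟨ *-distribˡ-+ a b b′ ⟩
    a * b + a * b′         ≤⟨ +-monoʳ-≤ (a * b) ab′≤a′b ⟩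
    a * b + a′ * b         ≡⟨ *-distribʳ-+ b a a′ ⟨
    (a + a′) * b           ∎) a≥αb
    where open ≤-Reasoning
  ... | inj₂ a′b≤ab′ = ≥α·-mono {a + a′} {b + b′} {a′} {b′} (begin
    a′ * (b + b′)          ≡⟨ *-distribˡ-+ a′ b b′ ⟩
    a′ * b + a′ * b′       ≤⟨ +-monoˡ-≤ (a′ * b′) a′b≤ab′ ⟩
    a * b′ + a′ * b′       ≡⟨ *-distribʳ-+ b′ a a′ ⟨
    (a + a′) * b′          ∎) a′≥αb′
    where open ≤-Reasoning

  pos-Φ : ∀ a b → (+ a) ℤ.^ k ℤ.+ (+ a) ℤ.* (+ b) ℤ.^ k′ ≡ + Φ a b
  pos-Φ a b = cong₂ ℤ._+_ (pos-^ a k)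
    (trans (cong (+ a ℤ.*_) (pos-^ b k′)) (sym (ℤ.pos-* a (b ^ k′))))

  ≤α·⇒Tℤ : ∀ {a b} → a ≤α· b → T ((+ a) ℤ.^ k ℤ.+ (+ a) ℤ.* (+ b) ℤ.^ k′ ℤ.≤ᵇ (+ b) ℤ.^ k)
  ≤α·⇒Tℤ {a} {b} a≤αb =
    subst₂ (λ x y → T (x ℤ.≤ᵇ y)) (sym (pos-Φ a b)) (sym (pos-^ b k)) (ℤ.≤⇒≤ᵇ (+≤+ a≤αb))

  Tℤ⇒≤α· : ∀ {a b} → T ((+ a) ℤ.^ k ℤ.+ (+ a) ℤ.* (+ b) ℤ.^ k′ ℤ.≤ᵇ (+ b) ℤ.^ k) → a ≤α· b
  Tℤ⇒≤α· {a} {b} t =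
    ℤ.drop‿+≤+ (ℤ.≤ᵇ⇒≤ (subst₂ (λ x y → T (x ℤ.≤ᵇ y)) (pos-Φ a b) (pos-^ b k) t))

  ≥α·⇒Tℤ : ∀ {a b} → a ≥α· b → T ((+ b) ℤ.^ k ℤ.≤ᵇ (+ a) ℤ.^ k ℤ.+ (+ a) ℤ.* (+ b) ℤ.^ k′)
  ≥α·⇒Tℤ {a} {b} a≥αb =
    subst₂ (λ x y → T (x ℤ.≤ᵇ y)) (sym (pos-^ b k)) (sym (pos-Φ a b)) (ℤ.≤⇒≤ᵇ (+≤+ a≥αb))

  Tℤ⇒≥α· : ∀ {a b} → T ((+ b) ℤ.^ k ℤ.≤ᵇ (+ a) ℤ.^ k ℤ.+ (+ a) ℤ.* (+ b) ℤ.^ k′) → a ≥α· b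
  Tℤ⇒≥α· {a} {b} t =
    ℤ.drop‿+≤+ (ℤ.≤ᵇ⇒≤ (subst₂ (λ x y → T (x ℤ.≤ᵇ y)) (pos-^ b k) (pos-Φ a b) t))

  -- The pairs (u , v) with u ≤ α v, classified by the signs of u and v.
  data HalfPlane (u v : ℤ) : Set where
    quadrant : u ℤ.≤ + 0 → + 0 ℤ.≤ v → HalfPlane u v
    positive : ∀ {a b} → u ≡ + a → v ≡ +[1+ b ] → a ≤α· suc b → HalfPlane u v
    negative : ∀ {a b} → u ≡ ℤ.- + a → v ≡ -[1+ b ] → a ≥α· suc b → HalfPlane u v

  HalfPlane⇒leqα : ∀ {u v} → HalfPlane u v → T (leqα k u v)
  HalfPlane⇒leqα {v = + zero}   (quadrant u≤0 _) = ℤ.≤⇒≤ᵇ u≤0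
  HalfPlane⇒leqα {v = +[1+ _ ]} (quadrant u≤0 _) = Equivalence.from T-∨ (inj₁ (ℤ.≤⇒≤ᵇ u≤0))
  HalfPlane⇒leqα (positive {a} {b} refl refl a≤αb) =
    Equivalence.from T-∨ (inj₂ (≤α·⇒Tℤ {a} {suc b} a≤αb))
  HalfPlane⇒leqα (negative {a} {b} refl refl a≥αb) rewrite ℤ.neg-involutive (+ a) =
    Equivalence.from T-∧ (ℤ.≤⇒≤ᵇ (+≤+ (z≤n {a})) , ≥α·⇒Tℤ {a} {suc b} a≥αb)

  leqα⇒HalfPlane : ∀ {u v} → T (leqα k u v) → HalfPlane u v
  leqα⇒HalfPlane {u}        {+ zero}    t = quadrant (ℤ.≤ᵇ⇒≤ t) (+≤+ z≤n)
  leqα⇒HalfPlane { -[1+ _ ]} {+[1+ _ ]} _ = quadrant -≤+ (+≤+ z≤n)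
  leqα⇒HalfPlane {+ a}      {+[1+ b ]}  t with Equivalence.to T-∨ t
  ... | inj₁ u≤0 = quadrant (ℤ.≤ᵇ⇒≤ u≤0) (+≤+ z≤n)
  ... | inj₂ t′  = positive refl refl (Tℤ⇒≤α· {a} {suc b} t′)
  leqα⇒HalfPlane {+[1+ _ ]} { -[1+ _ ]} ()
  leqα⇒HalfPlane {+ zero}   { -[1+ b ]} t =
    negative {a = 0} refl refl (Tℤ⇒≥α· {0} {suc b} (proj₂ (Equivalence.to T-∧ t)))
  leqα⇒HalfPlane { -[1+ a ]} { -[1+ b ]} t =
    negative {a = suc a} refl refl (Tℤ⇒≥α· {suc a} {suc b} (proj₂ (Equivalence.to T-∧ t)))

  HalfPlane-nonneg : ∀ {a b} → a ≤α· b → HalfPlane (+ a) (+ b)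
  HalfPlane-nonneg {a} {zero}  a≤α0 rewrite m^n≡0⇒m≡0 a k (m+n≡0⇒m≡0 (a ^ k) (n≤0⇒n≡0 a≤α0)) =
    quadrant (+≤+ z≤n) (+≤+ z≤n)
  HalfPlane-nonneg {a} {suc b} a≤αb = positive refl refl a≤αb

  HalfPlane-nonpos : ∀ {a b} → a ≥α· b → HalfPlane (ℤ.- + a) (ℤ.- + b)
  HalfPlane-nonpos {a} {zero}  _    = quadrant ℤ.neg-≤-pos (+≤+ z≤n)
  HalfPlane-nonpos {a} {suc b} a≥αb = negative refl refl a≥αb

  HalfPlane-monoˡ : ∀ {u u′ v} → u′ ℤ.≤ u → HalfPlane u v → HalfPlane u′ v
  HalfPlane-monoˡ u′≤u (quadrant u≤0 0≤v) = quadrant (ℤ.≤-trans u′≤u u≤0) 0≤v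
  HalfPlane-monoˡ {u′ = -[1+ _ ]} _ (positive refl refl _) = quadrant -≤+ (+≤+ z≤n)
  HalfPlane-monoˡ {u′ = + c} (+≤+ c≤a) (positive {a} {b} refl refl a≤αb) =
    positive refl refl (≤α·-anti {c} {suc b} {a} {suc b} (*-monoˡ-≤ (suc b) c≤a) a≤αb)
  HalfPlane-monoˡ {u′ = +[1+ _ ]} u′≤u (negative {zero} refl refl _) with u′≤u
  ... | +≤+ ()
  HalfPlane-monoˡ {u′ = +[1+ _ ]} () (negative {suc _} refl refl _)
  HalfPlane-monoˡ {u′ = + zero} u′≤u (negative {a} {b} refl refl a≥αb) =
    negative {a = 0} refl refl (≥α·-mono {0} {suc b} {a} {suc b}
      (*-monoˡ-≤ (suc b) (ℤ.drop‿+≤+ (ℤ.neg-cancel-≤ {+ 0} {+ a} u′≤u))) a≥αb)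
  HalfPlane-monoˡ {u′ = -[1+ c ]} u′≤u (negative {a} {b} refl refl a≥αb) =
    negative {a = suc c} refl refl (≥α·-mono {suc c} {suc b} {a} {suc b}
      (*-monoˡ-≤ (suc b) (ℤ.drop‿+≤+ (ℤ.neg-cancel-≤ {+ suc c} {+ a} u′≤u))) a≥αb)

  HalfPlane-monoʳ : ∀ {u v v′} → v ℤ.≤ v′ → HalfPlane u v → HalfPlane u v′
  HalfPlane-monoʳ v≤v′ (quadrant u≤0 0≤v) = quadrant u≤0 (ℤ.≤-trans 0≤v v≤v′)
  HalfPlane-monoʳ {v′ = +[1+ c ]} (+≤+ (s≤s b≤c)) (positive {a} {b} refl refl a≤αb) =
    positive refl refl (≤α·-anti {a} {suc c} {a} {suc b} (*-monoʳ-≤ a (s≤s b≤c)) a≤αb)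
  HalfPlane-monoʳ {v′ = + zero} (+≤+ ()) (positive refl refl _)
  HalfPlane-monoʳ {v′ = + _} _ (negative refl refl _) = quadrant ℤ.neg-≤-pos (+≤+ z≤n)
  HalfPlane-monoʳ {v′ = -[1+ c ]} (-≤- c≤b) (negative {a} {b} refl refl a≥αb) =
    negative refl refl (≥α·-mono {a} {suc c} {a} {suc b} (*-monoʳ-≤ a (s≤s c≤b)) a≥αb)

  private
    HalfPlane-comm : ∀ {u v u′ v′} →
                     HalfPlane (u ℤ.+ u′) (v ℤ.+ v′) → HalfPlane (u′ ℤ.+ u) (v′ ℤ.+ v)
    HalfPlane-comm {u} {v} {u′} {v′} = subst₂ HalfPlane (ℤ.+-comm u u′) (ℤ.+-comm v v′)

    quadrant-+ : ∀ {u v u′ v′} → u ℤ.≤ + 0 → + 0 ℤ.≤ v →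
                 HalfPlane u′ v′ → HalfPlane (u ℤ.+ u′) (v ℤ.+ v′)
    quadrant-+ {u} {v} {u′} {v′} u≤0 0≤v =
      HalfPlane-monoˡ (ℤ.≤-trans (ℤ.+-monoˡ-≤ u′ u≤0) (ℤ.≤-reflexive (ℤ.+-identityˡ u′))) ∘
      HalfPlane-monoʳ (ℤ.≤-trans (ℤ.≤-reflexive (sym (ℤ.+-identityˡ v′))) (ℤ.+-monoˡ-≤ v′ 0≤v))

    positive-+-negative : ∀ {a b a′ b′} → a ≤α· suc b → a′ ≥α· suc b′ →
                          HalfPlane (a ℤ.⊖ a′) (suc b ℤ.⊖ suc b′)
    positive-+-negative {a} {b} {a′} {b′} a≤αb a′≥αb′
      with ≤α·-≥α·-cross {a} {suc b} {a′} {suc b′} a≤αb a′≥αb′ | ≤-total b′ b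
    ... | cross | inj₁ b′≤b rewrite ℤ.⊖-≥ (s≤s b′≤b) with ≤-total a′ a
    ...   | inj₂ a≤a′ rewrite ℤ.⊖-≤ a≤a′ = quadrant ℤ.neg-≤-pos (+≤+ z≤n)
    ...   | inj₁ a′≤a rewrite ℤ.⊖-≥ a′≤a =
      HalfPlane-nonneg (≤α·-anti {a ∸ a′} {b ∸ b′} {a} {suc b} (begin
        (a ∸ a′) * suc b          ≡⟨ *-distribʳ-∸ (suc b) a a′ ⟩
        a * suc b ∸ a′ * suc b    ≤⟨ ∸-monoʳ-≤ (a * suc b) cross ⟩
        a * suc b ∸ a * suc b′    ≡⟨ *-distribˡ-∸ a (suc b) (suc b′) ⟨
        a * (b ∸ b′)              ∎) a≤αb)
      where open ≤-Reasoning
    positive-+-negative {a} {b} {a′} {b′} a≤αb a′≥αb′ | cross | inj₂ b≤b′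
      rewrite ℤ.⊖-≤ (s≤s b≤b′)
            | ℤ.⊖-≤ (*-cancelʳ-≤ a a′ (suc b′) (≤-trans cross (*-monoʳ-≤ a′ (s≤s b≤b′)))) =
      HalfPlane-nonpos (≥α·-mono {a′ ∸ a} {b′ ∸ b} {a′} {suc b′} (begin
        a′ * (b′ ∸ b)             ≡⟨ *-distribˡ-∸ a′ (suc b′) (suc b) ⟩
        a′ * suc b′ ∸ a′ * suc b  ≤⟨ ∸-monoʳ-≤ (a′ * suc b′) cross ⟩
        a′ * suc b′ ∸ a * suc b′  ≡⟨ *-distribʳ-∸ (suc b′) a′ a ⟨
        (a′ ∸ a) * suc b′         ∎) a′≥αb′)
      where open ≤-Reasoning

  HalfPlane-+ : ∀ {u v u′ v′} → HalfPlane u v → HalfPlane u′ v′ → HalfPlane (u ℤ.+ u′) (v ℤ.+ v′)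
  HalfPlane-+ (quadrant u≤0 0≤v) h′ = quadrant-+ u≤0 0≤v h′
  HalfPlane-+ {u} {v} {u′} {v′} h (quadrant u′≤0 0≤v′) =
    HalfPlane-comm {u′} {v′} {u} {v} (quadrant-+ u′≤0 0≤v′ h)
  HalfPlane-+ (positive {a} {b} refl refl a≤αb) (positive {a′} {b′} refl refl a′≤αb′) =
    positive refl refl (≤α·-mediant {a} {suc b} {a′} {suc b′} a≤αb a′≤αb′)
  HalfPlane-+ (negative {a} {b} refl refl a≥αb) (negative {a′} {b′} refl refl a′≥αb′) =
    negative (sym (ℤ.neg-distrib-+ (+ a) (+ a′))) refl
      (subst (λ c → a + a′ ≥α· suc c) (+-suc b b′)
             (≥α·-mediant {a} {suc b} {a′} {suc b′} a≥αb a′≥αb′))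
  HalfPlane-+ (positive {a} {b} refl refl a≤αb) (negative {a′} {b′} refl refl a′≥αb′) =
    subst (λ u → HalfPlane u _) (sym (ℤ.m-n≡m⊖n a a′))
      (positive-+-negative {a} {b} {a′} {b′} a≤αb a′≥αb′)
  HalfPlane-+ (negative {a} {b} refl refl a≥αb) (positive {a′} {b′} refl refl a′≤αb′) =
    HalfPlane-comm {+ a′} {+[1+ b′ ]} {ℤ.- + a} { -[1+ b ]}
      (subst (λ u → HalfPlane u _) (sym (ℤ.m-n≡m⊖n a′ a))
             (positive-+-negative {a′} {b′} {a} {b} a′≤αb′ a≥αb))

  HalfPlane-total : ∀ u v → HalfPlane u v ⊎ HalfPlane (ℤ.- u) (ℤ.- v)
  HalfPlane-total -[1+ _ ] (+ _) = inj₁ (quadrant -≤+ (+≤+ z≤n))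
  HalfPlane-total (+ _) -[1+ _ ] = inj₂ (quadrant ℤ.neg-≤-pos (+≤+ z≤n))
  HalfPlane-total (+ a) (+ b) with ≤-total (Φ a b) (b ^ k)
  ... | inj₁ a≤αb = inj₁ (HalfPlane-nonneg a≤αb)
  ... | inj₂ a≥αb = inj₂ (HalfPlane-nonpos a≥αb)
  HalfPlane-total -[1+ a ] -[1+ b ] with ≤-total (Φ (suc a) (suc b)) (suc b ^ k)
  ... | inj₁ a≤αb = inj₂ (positive refl refl a≤αb)
  ... | inj₂ a≥αb = inj₁ (negative refl refl a≥αb)

  private
    neg-minus : ∀ i j → ℤ.- (i ℤ.- j) ≡ j ℤ.- i
    neg-minus = solve 2 (λ i j → :- (i :- j) := j :- i) refl
      where open IntSolver

    [i+l]-[j+l]≡i-j : ∀ i j l → (i ℤ.+ l) ℤ.- (j ℤ.+ l) ≡ i ℤ.- j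
    [i+l]-[j+l]≡i-j = solve 3 (λ i j l → (i :+ l) :- (j :+ l) := i :- j) refl
      where open IntSolver

    toHalfPlane : ∀ {a b c d} → (a , b) ≤[ k ] (c , d) → HalfPlane (a ℤ.- c) (b ℤ.- d)
    toHalfPlane {a} {b} {c} {d} = leqα⇒HalfPlane {a ℤ.- c} {b ℤ.- d}

    fromHalfPlane : ∀ {a b c d} → HalfPlane (a ℤ.- c) (b ℤ.- d) → (a , b) ≤[ k ] (c , d)
    fromHalfPlane = HalfPlane⇒leqα

  ≤[k]-refl : ∀ x → x ≤[ k ] x
  ≤[k]-refl (a , b) = fromHalfPlane {a} {b} {a} {b}
    (subst₂ HalfPlane (sym (ℤ.+-inverseʳ a)) (sym (ℤ.+-inverseʳ b)) (quadrant ℤ.≤-refl ℤ.≤-refl))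

  ≤[k]-trans : ∀ x y z → x ≤[ k ] y → y ≤[ k ] z → x ≤[ k ] z
  ≤[k]-trans (a , b) (c , d) (e , f) x≤y y≤z = fromHalfPlane {a} {b} {e} {f}
    (subst₂ HalfPlane (ℤ.+-minus-telescope a c e) (ℤ.+-minus-telescope b d f)
      (HalfPlane-+ (toHalfPlane {a} {b} {c} {d} x≤y) (toHalfPlane {c} {d} {e} {f} y≤z)))

  ≤[k]-total : ∀ x y → x ≤[ k ] y ⊎ y ≤[ k ] x
  ≤[k]-total (a , b) (c , d) with HalfPlane-total (a ℤ.- c) (b ℤ.- d)
  ... | inj₁ h = inj₁ (fromHalfPlane {a} {b} {c} {d} h)
  ... | inj₂ h =
    inj₂ (fromHalfPlane {c} {d} {a} {b} (subst₂ HalfPlane (neg-minus a c) (neg-minus b d) h))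

  ⊕-monoˡ-≤[k] : ∀ x y z → x ≤[ k ] y → (x ⊕ z) ≤[ k ] (y ⊕ z)
  ⊕-monoˡ-≤[k] (a , b) (c , d) (e , f) x≤y =
    subst₂ (λ u v → T (leqα k u v)) (sym ([i+l]-[j+l]≡i-j a c e)) (sym ([i+l]-[j+l]≡i-j b d f)) x≤y

  x≤maxV : ∀ x y → x ≤[ k ] maxV k x y
  x≤maxV x y with leqV k x y in eq
  ... | true  = subst T (sym eq) _
  ... | false = ≤[k]-refl x

  y≤maxV : ∀ x y → y ≤[ k ] maxV k x y
  y≤maxV x y with leqV k x y | ≤[k]-total x y
  ... | true  | _        = ≤[k]-refl y
  ... | false | inj₂ y≤x = y≤x
  ... | false | inj₁ ()

  maxV-sel : ∀ x y → maxV k x y ≡ x ⊎ maxV k x y ≡ y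
  maxV-sel x y with leqV k x y
  ... | true  = inj₂ refl
  ... | false = inj₁ refl

  minV≤x : ∀ x y → minV k x y ≤[ k ] x
  minV≤x x y with leqV k x y | ≤[k]-total x y
  ... | true  | _        = ≤[k]-refl x
  ... | false | inj₂ y≤x = y≤x
  ... | false | inj₁ ()

  minV≤y : ∀ x y → minV k x y ≤[ k ] y
  minV≤y x y with leqV k x y in eq
  ... | true  = subst T (sym eq) _
  ... | false = ≤[k]-refl y

  minV-sel : ∀ x y → minV k x y ≡ x ⊎ minV k x y ≡ y
  minV-sel x y with leqV k x y
  ... | true  = inj₁ refl
  ... | false = inj₂ refl

-- Stated for an abstract selection so that it covers both (≤, maxV) for M and (≥, minV) for m.
module Extremal (k′ : ℕ) (_≼_ : Val → Val → Set)
  (≼-refl : ∀ x → x ≼ x)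
  (≼-trans : ∀ x y z → x ≼ y → y ≼ z → x ≼ z)
  (⊕-monoˡ-≼ : ∀ x y z → x ≼ y → (x ⊕ z) ≼ (y ⊕ z))
  (sel : Val → Val → Val)
  (x≼sel : ∀ x y → x ≼ sel x y)
  (y≼sel : ∀ x y → y ≼ sel x y)
  (sel-either : ∀ x y → sel x y ≡ x ⊎ sel x y ≡ y)
  where

  open Hofstadter k′

  private
    k : ℕ
    k = suc k′

  Extremum : ℕ → Val → Set
  Extremum p V = (∀ n → n < A k p → δ k n ≼ V) × ∃[ n ] (n < A k p × δ k n ≼ V × V ≼ δ k n)

  extremum-zero : Extremum 0 denZero
  extremum-zero = bound , (0 , s≤s z≤n , ≼-refl denZero , ≼-refl denZero)
    where
    bound : ∀ n → n < A k 0 → δ k n ≼ denZero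
    bound n n<1 rewrite n<1⇒n≡0 n<1 = ≼-refl denZero

  extremum-suc : ∀ {p V W} → Extremum p V → Extremum (suc p ∸ k) W →
                 Extremum (suc p) (sel V (W ⊕ δ k (A k p)))
  extremum-suc {p} {V} {W} (V-bound , (n , n<A , δ≼V , V≼δ)) (W-bound , (r , r<b , δ≼W , W≼δ)) =
    bound , attained (sel-either V (W ⊕ δ k (A k p)))
    where
    bound : ∀ n → n < A k (suc p) → δ k n ≼ sel V (W ⊕ δ k (A k p))
    bound n n<A′ with A-split p n<A′
    ... | inj₁ n<A = ≼-trans _ _ _ (V-bound n n<A) (x≼sel V _)
    ... | inj₂ (r′ , r′<b , refl) =
      subst (_≼ sel V (W ⊕ δ k (A k p))) (sym (δ[A+r]≡δ[r]⊕δ[A] p r′<b))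
            (≼-trans _ _ _ (⊕-monoˡ-≼ _ _ (δ k (A k p)) (W-bound r′ r′<b)) (y≼sel V _))
    A+r<A′ : A k p + r < A k (suc p)
    A+r<A′ = subst (A k p + r <_) (sym (A-rec p)) (+-monoʳ-< (A k p) r<b)
    attained : ∀ {S} → S ≡ V ⊎ S ≡ W ⊕ δ k (A k p) →
               ∃[ n ] (n < A k (suc p) × δ k n ≼ S × S ≼ δ k n)
    attained (inj₁ refl) = n , <-≤-trans n<A (A-mono (n≤1+n p)) , δ≼V , V≼δ
    attained (inj₂ refl) = A k p + r , A+r<A′ ,
      subst (_≼ (W ⊕ δ k (A k p))) δ-split (⊕-monoˡ-≼ _ _ (δ k (A k p)) δ≼W) ,
      subst ((W ⊕ δ k (A k p)) ≼_) δ-split (⊕-monoˡ-≼ _ _ (δ k (A k p)) W≼δ)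
      where
      δ-split : δ k r ⊕ δ k (A k p) ≡ δ k (A k p + r)
      δ-split = sym (δ[A+r]≡δ[r]⊕δ[A] p r<b)

  module Sequence (X : ℕ → Val) (X-zero : X 0 ≡ denZero)
    (X-suc : ∀ p → X (suc p) ≡ sel (X p) (X (suc p ∸ k) ⊕ δ k (A k p))) where

    extremum : ∀ p → Extremum p (X p)
    extremum = <-rec (λ p → Extremum p (X p)) step
      where
      step : ∀ p → (∀ {q} → q < p → Extremum q (X q)) → Extremum p (X p)
      step zero    _   rewrite X-zero = extremum-zero
      step (suc p) rec rewrite X-suc p = extremum-suc (rec ≤-refl) (rec (s≤s (m∸n≤m p k′)))

    monotone : ∀ p → X p ≼ X (suc p)
    monotone p = subst (X p ≼_) (sym (X-suc p)) (x≼sel (X p) _)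

    cofinal : ∀ n → ∃[ p ] (δ k n ≼ X p)
    cofinal n = n , proj₁ (extremum n) n (p<A[p] n)

    realised : ∀ p → ∃[ n ] (X p ≼ δ k n)
    realised p with proj₂ (extremum p)
    ... | n , _ , _ , X≼δ = n , X≼δ

module _ (k′ : ℕ) where
  private
    k : ℕ
    k = suc k′

    M-unfold : ∀ p → ∃[ t ] (M k (suc p) ≡ maxV k (t p) (t (suc p ∸ k) ⊕ δ k (A k p))
                             × (∀ {j} → j < suc p → t j ≡ M k j))
    M-unfold p = cov-step denZero _ (suc p)

    m-unfold : ∀ p → ∃[ t ] (m k (suc p) ≡ minV k (t p) (t (suc p ∸ k) ⊕ δ k (A k p))
                             × (∀ {j} → j < suc p → t j ≡ m k j))
    m-unfold p = cov-step denZero _ (suc p)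

  M-suc : ∀ p → M k (suc p) ≡ maxV k (M k p) (M k (suc p ∸ k) ⊕ δ k (A k p))
  M-suc p with M-unfold p
  ... | t , eq , t≗M =
    trans eq (cong₂ (λ x y → maxV k x (y ⊕ δ k (A k p))) (t≗M ≤-refl) (t≗M (s≤s (m∸n≤m p k′))))

  m-suc : ∀ p → m k (suc p) ≡ minV k (m k p) (m k (suc p ∸ k) ⊕ δ k (A k p))
  m-suc p with m-unfold p
  ... | t , eq , t≗m =
    trans eq (cong₂ (λ x y → minV k x (y ⊕ δ k (A k p))) (t≗m ≤-refl) (t≗m (s≤s (m∸n≤m p k′))))

proposition8p8 :
  (k : ℕ) → 1 ≤ k →
    ((p : ℕ) →
      ((∀ n → n < A k p → δ k n ≤[ k ] M k p) × (∃[ n ] (n < A k p × δ k n ≈[ k ] M k p)))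
      × ((∀ n → n < A k p → m k p ≤[ k ] δ k n) × (∃[ n ] (n < A k p × δ k n ≈[ k ] m k p))))
    × (((∀ p → M k p ≤[ k ] M k (suc p))
        × (∀ n → ∃[ p ] (δ k n ≤[ k ] M k p)) × (∀ p → ∃[ n ] (M k p ≤[ k ] δ k n)))
      × ((∀ p → m k (suc p) ≤[ k ] m k p)
        × (∀ n → ∃[ p ] (m k p ≤[ k ] δ k n)) × (∀ p → ∃[ n ] (δ k n ≤[ k ] m k p))))
proposition8p8 zero    ()
proposition8p8 (suc k′) _ =
    (λ p → Max.extremum p , map₂ (map₂ (map₂ swap)) (Min.extremum p))
  , (Max.monotone , Max.cofinal , Max.realised)
  , (Min.monotone , Min.cofinal , Min.realised)
  where
  open RootOrder k′
  module Max = Extremal.Sequence k′ _≤[ suc k′ ]_ ≤[k]-refl ≤[k]-trans ⊕-monoˡ-≤[k]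
    (maxV (suc k′)) x≤maxV y≤maxV maxV-sel (M (suc k′)) refl (M-suc k′)
  module Min = Extremal.Sequence k′ (λ x y → y ≤[ suc k′ ] x) ≤[k]-refl
    (λ x y z x≥y y≥z → ≤[k]-trans z y x y≥z x≥y) (λ x y → ⊕-monoˡ-≤[k] y x)
    (minV (suc k′)) minV≤x minV≤y minV-sel (m (suc k′)) refl (m-suc k′)
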